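{- Let $\rho$ be an integer polymatroid on $E=[n]$ with natural matroid $M_\rho$. For $A\subseteq E$, the following are equivalent: (1) $A$ is a cyclic set of $\rho$; (2) $X_A$ is a cyclic set of $M_\rho$ (a union of circuits of $M_\rho$); (3) for each $i\in A$, either $\rho(\{i\})=0$ or there is a circuit $\mathbf{u}$ of $\rho$ with $u_i>0$ and $u_j=0$ for all $j\in E-A$.
   Context: An integer polymatroid on $E=[n]$ is a function $\rho:2^E\to\mathbb{N}$ with $\rho(\emptyset)=0$, monotone and submodular. $A\subseteq E$ is cyclic if $\rho(A)<\rho(A-\{i\})+\rho(\{i\})$ for all $i\in A$ with $\rho(\{i\})>0$. Natural matroid: for each $i\in E$ let $X_i$ be a set of $\rho(\{i\})$ elements, the $X_i$ pairwise disjoint; $X_A=\bigcup_{i\in A}X_i$, $E'=X_E$; $M_\rho$ is the matroid on $E'$ with rank function $r(Y)=\min\{\rho(A)+|Y-X_A|:A\subseteq E\}$. For $\mathbf{u}\in\mathbb{N}^n$, $\mathbf{u}$ is independent if $\sum_{i\in X}u_i\le\rho(X)$ for all $X\subseteq E$. A circuit of $\rho$ is a vector $\mathbf{u}$ with $0\le u_i\le\rho(\{i\})$ for all $i$ that is not independent but every $\mathbf{w}\in\mathbb{N}^n$ with $\mathbf{w}\le\mathbf{u}$ componentwise and $\mathbf{w}\ne\mathbf{u}$ is independent. -}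

module Defs where

open import Data.Nat using (ℕ; zero; suc; _+_; _≤_; _<_; _⊓_)
open import Data.Bool using (Bool; true; false; if_then_else_)
open import Data.Fin using (Fin; zero; suc)
open import Data.Fin.Subset using (Subset; _∈_; _∉_; _⊆_; _∪_; _∩_; _-_; ⁅_⁆; ∣_∣; inside; outside)
  renaming (⊥ to ∅; ⊤ to full)
open import Data.Fin.Subset.Properties using (_∈?_)
open import Data.Vec using (Vec; []; _∷_)
open import Data.List using (List; []; _∷_; map; _++_; foldr)
open import Data.Product using (Σ; _×_; ∃; _,_)
open import Data.Sum using (_⊎_)
open import Relation.Nullary using (¬_; yes; no)
open import Relation.Binary.PropositionalEquality using (_≡_)

record IntPolymatroid (n : ℕ) : Set where
  field
    ρ          : Subset n → ℕ
    ρ-empty    : ρ ∅ ≡ 0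
    monotone   : ∀ {A B} → A ⊆ B → ρ A ≤ ρ B
    submodular : ∀ A B → ρ (A ∪ B) + ρ (A ∩ B) ≤ ρ A + ρ B

sumFin : ∀ {n} → (Fin n → ℕ) → ℕ
sumFin {zero}  f = 0
sumFin {suc n} f = f zero + sumFin (λ i → f (suc i))

sumOver : ∀ {n} → Subset n → (Fin n → ℕ) → ℕ
sumOver X u = sumFin (λ i → if ⌊ i ∈? X ⌋ then u i else 0)
  where open import Relation.Nullary.Decidable using (⌊_⌋)

allSubsets : ∀ n → List (Subset n)
allSubsets zero    = [] ∷ []
allSubsets (suc n) = map (outside ∷_) (allSubsets n) ++ map (inside ∷_) (allSubsets n)

module _ {n : ℕ} (P : IntPolymatroid n) where
  open IntPolymatroid P

  ρ₁ : Fin n → ℕ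
  ρ₁ i = ρ ⁅ i ⁆

  Cyclic : Subset n → Set
  Cyclic A = ∀ i → i ∈ A → 0 < ρ₁ i → ρ A < ρ (A - i) + ρ₁ i

  IndepVec : (Fin n → ℕ) → Set
  IndepVec u = ∀ (X : Subset n) → sumOver X u ≤ ρ X

  CircuitVec : (Fin n → ℕ) → Set
  CircuitVec u =
    (∀ i → u i ≤ ρ₁ i) ×
    ¬ IndepVec u ×
    (∀ (w : Fin n → ℕ) → (∀ i → w i ≤ u i) → ¬ (∀ i → w i ≡ u i) → IndepVec w)

  -- Natural matroid M_ρ.
  -- Ground set E' = X_E where X_i ≅ Fin (ρ{i}), pairwise disjoint; a subset
  -- Y ⊆ E' is given by its traces Y i ⊆ X_i.
  Elem : Set
  Elem = Σ (Fin n) (λ i → Fin (ρ₁ i))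

  SubE' : Set
  SubE' = (i : Fin n) → Subset (ρ₁ i)

  _∈'_ : Elem → SubE' → Set
  (i , k) ∈' Y = k ∈ Y i

  _⊆'_ : SubE' → SubE' → Set
  Y ⊆' Z = ∀ e → e ∈' Y → e ∈' Z

  card : SubE' → ℕ
  card Y = sumFin (λ i → ∣ Y i ∣)

  cardOutside : SubE' → Subset n → ℕ
  cardOutside Y A = sumFin (λ i → if ⌊ i ∈? A ⌋ then 0 else ∣ Y i ∣)
    where open import Relation.Nullary.Decidable using (⌊_⌋)

  X : Subset n → SubE'
  X A i = if ⌊ i ∈? A ⌋ then full else ∅
    where open import Relation.Nullary.Decidable using (⌊_⌋)

  -- r(Y) = min { ρ(A) + |Y - X_A| : A ⊆ E }
  -- (the fold is seeded with the value for A = ∅, which is among the candidates)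
  rank : SubE' → ℕ
  rank Y = foldr _⊓_ (ρ ∅ + cardOutside Y ∅)
                 (map (λ A → ρ A + cardOutside Y A) (allSubsets n))

  Dependent : SubE' → Set
  Dependent Y = rank Y < card Y

  Independent : SubE' → Set
  Independent Y = rank Y ≡ card Y

  MCircuit : SubE' → Set
  MCircuit C = Dependent C ×
    (∀ D → D ⊆' C → (∃ λ e → e ∈' C × ¬ (e ∈' D)) → Independent D)

  MCyclic : SubE' → Set
  MCyclic Y = ∀ e → e ∈' Y → ∃ λ C → MCircuit C × C ⊆' Y × e ∈' C

  Cond3 : Subset n → Set
  Cond3 A = ∀ i → i ∈ A →
    ρ₁ i ≡ 0 ⊎
    (∃ λ u → CircuitVec u × 0 < u i × (∀ j → j ∉ A → u j ≡ 0))

-- A is cyclic at i when ρ(A − i) + ρ({i}) > ρ(A).  In that case, extend an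
-- independent vector spanning A − i (built greedily, one element at a time) by
-- ρ({i}) at i: the result is dependent but becomes independent once its i-th
-- entry is cleared, so lowering entries while staying dependent ends at a
-- circuit u supported on A with u_i > 0.  Conversely, if ρ(A − i) + ρ({i}) ≤ ρ(A)
-- then, by the diminishing returns of submodularity, the same holds for every Y
-- with i ∈ Y ⊆ A; with the independence of u with its i-th entry cleared this
-- gives u(Y) ≤ ρ(Y) for all Y, so no circuit supported on A uses i.  Finally, a
-- subset Y of the ground set of M_ρ is independent iff its vector of sizes
-- (|Y ∩ X_i|)_i is independent for ρ, so the circuits of M_ρ inside X_A are the
-- sets whose size vectors are circuits of ρ supported on A, and (2) reduces to (3).

module Submission where

open import Defs
open import Data.Nat
  using (ℕ; zero; suc; pred; _+_; _≤_; _<_; _⊓_; z≤n; s≤s⁻¹; _≤?_; _<?_; >-nonZero⁻¹)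
  renaming (_≟_ to _≟ℕ_)
open import Data.Nat.Properties
  using ( ≤-refl; ≤-reflexive; ≤-trans; ≤-antisym; ≤-<-trans; <-irrefl; <⇒≢; <⇒≱; ≮⇒≥; ≰⇒>; ≤∧≢⇒<
        ; n<1+n; n≢0⇒n>0; n>0⇒n≢0; n≤0⇒n≡0; pred[n]≤n; <⇒≤pred; m≤n+m; m≤n⇒∃[o]m+o≡n
        ; +-assoc; +-comm; +-identityʳ; +-mono-≤; +-monoˡ-≤; +-monoʳ-≤; +-mono-<-≤; +-mono-≤-<
        ; +-cancelˡ-≤; +-cancelʳ-≤; +-commutativeSemigroup; m⊓n≤m; m⊓n≤n; ⊓-glb; module ≤-Reasoning)
open import Data.Nat.Induction using (<-wellFounded)
open import Algebra.Properties.CommutativeSemigroup +-commutativeSemigroup using (interchange)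
open import Data.Bool using (if_then_else_)
open import Data.Fin using (Fin; zero; suc; _≟_; fromℕ<)
open import Data.Fin.Properties using (any?; ¬∀⟶∃¬; suc-injective; nonZeroIndex)
open import Data.Fin.Subset
  using (Subset; _∈_; _∉_; _⊆_; _∪_; _∩_; _─_; _-_; ⁅_⁆; ∣_∣; inside; outside)
  renaming (⊥ to ∅; ⊤ to full)
open import Data.Fin.Subset.Properties
  using ( _∈?_; nonempty?; anySubset?; Empty-unique; ∈⊤; ∉⊥; ⊥⊆; out⊆; s⊆s; ⊆-antisym
        ; x∈⁅x⁆; x≢y⇒x∉⁅y⁆; x∈p∧x≢y⇒x∈p-y; p─q⊆p; p∩q⊆p; p∩q⊆q
        ; x∈p∩q⁺; x∈p∩q⁻; x∈p∪q⁺; x∈p∪q⁻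
        ; ∣p∣≤n; ∣⊥∣≡0; ∣⊤∣≡n; p⊆q⇒∣p∣≤∣q∣; p⊂q⇒∣p∣<∣q∣; x∈p⇒∣p-x∣<∣p∣)
open import Data.Vec using ([]; _∷_; here; there)
open import Data.Vec.Functional using (updateAt)
open import Data.Vec.Functional.Properties using (updateAt-updates; updateAt-minimal)
open import Data.Vec.Functional.Relation.Binary.Pointwise using (Pointwise)
open import Data.List using ([]; _∷_; map; foldr)
import Data.List.Membership.Propositional as List
open import Data.List.Membership.Propositional.Properties using (∈-map⁺; ∈-++⁺ˡ; ∈-++⁺ʳ)
open import Data.List.Relation.Unary.Any using (here; there)
open import Data.Product using (∃; _×_; _,_; proj₁; proj₂)
open import Data.Sum using (inj₁; inj₂)
open import Function using (const; _∘_; _on_)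
open import Function.Bundles using (_⇔_; mk⇔; Equivalence)
open import Induction.WellFounded using (Acc; acc)
import Relation.Binary.Construct.On as On
open import Relation.Nullary using (¬_; Dec; yes; no; contradiction)
open import Relation.Nullary.Decidable using (⌊_⌋; _×-dec_; ¬?; decidable-stable)
open import Relation.Binary.PropositionalEquality
  using (_≡_; _≢_; _≗_; refl; sym; trans; cong; cong₂; subst; subst₂; module ≡-Reasoning)

infix 4 _≤ᵥ_

_≤ᵥ_ : ∀ {n} → (Fin n → ℕ) → (Fin n → ℕ) → Set
_≤ᵥ_ = Pointwise _≤_

≤ᵥ-refl : ∀ {n} {u : Fin n → ℕ} → u ≤ᵥ u
≤ᵥ-refl k = ≤-refl

≤ᵥ-trans : ∀ {n} {u v w : Fin n → ℕ} → u ≤ᵥ v → v ≤ᵥ w → u ≤ᵥ w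
≤ᵥ-trans u≤v v≤w k = ≤-trans (u≤v k) (v≤w k)

sumFin-cong : ∀ {n} {f g : Fin n → ℕ} → f ≗ g → sumFin f ≡ sumFin g
sumFin-cong {zero}  f≗g = refl
sumFin-cong {suc n} f≗g = cong₂ _+_ (f≗g zero) (sumFin-cong (λ i → f≗g (suc i)))

sumFin-mono : ∀ {n} {f g : Fin n → ℕ} → f ≤ᵥ g → sumFin f ≤ sumFin g
sumFin-mono {zero}  f≤g = z≤n
sumFin-mono {suc n} f≤g = +-mono-≤ (f≤g zero) (sumFin-mono (λ i → f≤g (suc i)))

sumFin-mono-< : ∀ {n} {f g : Fin n → ℕ} j → f ≤ᵥ g → f j < g j → sumFin f < sumFin g
sumFin-mono-< zero    f≤g fj<gj = +-mono-<-≤ fj<gj (sumFin-mono (λ i → f≤g (suc i)))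
sumFin-mono-< (suc j) f≤g fj<gj = +-mono-≤-< (f≤g zero) (sumFin-mono-< j (λ i → f≤g (suc i)) fj<gj)

sumFin-+ : ∀ {n} (f g : Fin n → ℕ) → sumFin (λ i → f i + g i) ≡ sumFin f + sumFin g
sumFin-+ {zero}  f g = refl
sumFin-+ {suc n} f g = begin
  f zero + g zero + sumFin (λ i → f (suc i) + g (suc i))
    ≡⟨ cong (f zero + g zero +_) (sumFin-+ (λ i → f (suc i)) (λ i → g (suc i))) ⟩
  f zero + g zero + (sumFin (λ i → f (suc i)) + sumFin (λ i → g (suc i)))
    ≡⟨ interchange (f zero) (g zero) _ _ ⟩
  f zero + sumFin (λ i → f (suc i)) + (g zero + sumFin (λ i → g (suc i))) ∎
  where open ≡-Reasoning

sumFin-zero : ∀ {n} {f : Fin n → ℕ} → (∀ k → f k ≡ 0) → sumFin f ≡ 0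
sumFin-zero {zero}  f≡0 = refl
sumFin-zero {suc n} f≡0 = cong₂ _+_ (f≡0 zero) (sumFin-zero (λ k → f≡0 (suc k)))

sumFin-single : ∀ {n} {f : Fin n → ℕ} j → (∀ k → k ≢ j → f k ≡ 0) → sumFin f ≡ f j
sumFin-single {suc n} {f} zero off-j =
  trans (cong (f zero +_) (sumFin-zero (λ k → off-j (suc k) λ ()))) (+-identityʳ (f zero))
sumFin-single {suc n} (suc j) off-j =
  cong₂ _+_ (off-j zero λ ()) (sumFin-single j (λ k k≢j → off-j (suc k) (k≢j ∘ suc-injective)))

updateAt-elim : ∀ {A : Set} {n} (Q : Fin n → A → Set) {u : Fin n → A} {j f} →
  Q j (f (u j)) → (∀ k → k ≢ j → Q k (u k)) → ∀ k → Q k (updateAt u j f k)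
updateAt-elim Q {u} {j} at-j off-j k with k ≟ j
... | yes refl = subst (Q k) (sym (updateAt-updates k u)) at-j
... | no k≢j   = subst (Q k) (sym (updateAt-minimal k j u k≢j)) (off-j k k≢j)

updateAt-pred-≤ᵥ : ∀ {n} (v : Fin n → ℕ) j → updateAt v j pred ≤ᵥ v
updateAt-pred-≤ᵥ v j = updateAt-elim (λ k x → x ≤ v k) pred[n]≤n (λ _ _ → ≤-refl)

sumFin-updateAt-pred-< : ∀ {n} (v : Fin n → ℕ) {j} → 0 < v j → sumFin (updateAt v j pred) < sumFin v
sumFin-updateAt-pred-< v {j} 0<vj = sumFin-mono-< j (updateAt-pred-≤ᵥ v j)
  (subst (_< v j) (sym (updateAt-updates j v)) (pred< 0<vj))
  where
  pred< : ∀ {m} → 0 < m → pred m < m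
  pred< {suc m} _ = n<1+n m

x∈p─q⇒x∉q : ∀ {n} (p q : Subset n) {x} → x ∈ p ─ q → x ∉ q
x∈p─q⇒x∉q (_ ∷ p) (inside ∷ q) () here
x∈p─q⇒x∉q (_ ∷ p) (_ ∷ q) (there x∈p─q) (there x∈q) = x∈p─q⇒x∉q p q x∈p─q x∈q

x∈p-y⇒x∈p : ∀ {n} {p : Subset n} {x y} → x ∈ p - y → x ∈ p
x∈p-y⇒x∈p {p = p} {y = y} = p─q⊆p p ⁅ y ⁆

x∈p-y⇒x≢y : ∀ {n} {p : Subset n} {x y} → x ∈ p - y → x ≢ y
x∈p-y⇒x≢y {p = p} {y = y} x∈p-y refl = x∈p─q⇒x∉q p ⁅ y ⁆ x∈p-y (x∈⁅x⁆ y)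

x∉p-x : ∀ {n} {p : Subset n} {x} → x ∉ p - x
x∉p-x x∈p-x = x∈p-y⇒x≢y x∈p-x refl

removal-induction : ∀ {n} (Q : Subset n → Set) → Q ∅ →
  (∀ {S j} → j ∈ S → Q (S - j) → Q S) → ∀ S → Q S
removal-induction Q Q∅ Q-insert S = go S (On.wellFounded ∣_∣ <-wellFounded S)
  where
  go : ∀ S → Acc (_<_ on ∣_∣) S → Q S
  go S (acc rec) with nonempty? S
  ... | yes (j , j∈S) = Q-insert j∈S (go (S - j) (rec (x∈p⇒∣p-x∣<∣p∣ j∈S)))
  ... | no S-empty    = subst Q (sym (Empty-unique S-empty)) Q∅

∣p∣<∣q∣⇒∃∈q∖p : ∀ {n} {p q : Subset n} → ∣ p ∣ < ∣ q ∣ → ∃ λ x → x ∈ q × x ∉ p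
∣p∣<∣q∣⇒∃∈q∖p {p = p} {q} ∣p∣<∣q∣ with any? (λ x → (x ∈? q) ×-dec ¬? (x ∈? p))
... | yes witness = witness
... | no none     = contradiction (p⊆q⇒∣p∣≤∣q∣ q⊆p) (<⇒≱ ∣p∣<∣q∣)
  where
  q⊆p : q ⊆ p
  q⊆p {x} x∈q = decidable-stable (x ∈? p) (λ x∉p → none (x , x∈q , x∉p))

x∈p⇒0<∣p∣ : ∀ {n} {p : Subset n} {x} → x ∈ p → 0 < ∣ p ∣
x∈p⇒0<∣p∣ x∈p = ≤-<-trans z≤n (x∈p⇒∣p-x∣<∣p∣ x∈p)

∃-⊆-of-size : ∀ {m} (p : Subset m) c → c ≤ ∣ p ∣ → ∃ λ q → q ⊆ p × ∣ q ∣ ≡ c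
∃-⊆-of-size []            zero    _ = [] , (λ ()) , refl
∃-⊆-of-size (outside ∷ p) c       c≤ with ∃-⊆-of-size p c c≤
... | q , q⊆p , ∣q∣≡c = outside ∷ q , out⊆ q⊆p , ∣q∣≡c
∃-⊆-of-size {suc m} (inside ∷ p) zero _ = ∅ , ⊥⊆ , ∣⊥∣≡0 (suc m)
∃-⊆-of-size (inside ∷ p)  (suc c) c≤ with ∃-⊆-of-size p c (s≤s⁻¹ c≤)
... | q , q⊆p , ∣q∣≡c = inside ∷ q , s⊆s q⊆p , cong suc ∣q∣≡c

∃-of-size : ∀ m c → c ≤ m → ∃ λ (q : Subset m) → ∣ q ∣ ≡ c
∃-of-size m c c≤m with ∃-⊆-of-size full c (subst (c ≤_) (sym (∣⊤∣≡n m)) c≤m)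
... | q , _ , ∣q∣≡c = q , ∣q∣≡c

∃-∋-of-size : ∀ {m} (x : Fin m) c → 0 < c → c ≤ m → ∃ λ q → x ∈ q × ∣ q ∣ ≡ c
∃-∋-of-size {suc m} zero    (suc c) _ c≤ with ∃-of-size m c (s≤s⁻¹ c≤)
... | q , ∣q∣≡c = inside ∷ q , here , cong suc ∣q∣≡c
∃-∋-of-size {suc m} (suc x) c 0<c c≤ with c ≤? m
... | yes c≤m with ∃-∋-of-size x c 0<c c≤m
...   | q , x∈q , ∣q∣≡c = outside ∷ q , there x∈q , ∣q∣≡c
∃-∋-of-size {suc m} (suc x) c 0<c c≤ | no c≰m =
  full , ∈⊤ , trans (∣⊤∣≡n (suc m)) (≤-antisym (≰⇒> c≰m) c≤)

allSubsets-complete : ∀ {n} (S : Subset n) → S List.∈ allSubsets n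
allSubsets-complete []            = here refl
allSubsets-complete (outside ∷ S) = ∈-++⁺ˡ (∈-map⁺ (outside ∷_) (allSubsets-complete S))
allSubsets-complete {suc n} (inside ∷ S) =
  ∈-++⁺ʳ (map (outside ∷_) (allSubsets n)) (∈-map⁺ (inside ∷_) (allSubsets-complete S))

foldr-⊓-≤ : ∀ {A : Set} (f : A → ℕ) s {x} xs → x List.∈ xs → foldr _⊓_ s (map f xs) ≤ f x
foldr-⊓-≤ f s (y ∷ xs) (here refl) = m⊓n≤m _ _
foldr-⊓-≤ f s (y ∷ xs) (there x∈xs) = ≤-trans (m⊓n≤n _ _) (foldr-⊓-≤ f s xs x∈xs)

foldr-⊓-greatest : ∀ {A : Set} (f : A → ℕ) {s c} xs → c ≤ s → (∀ x → c ≤ f x) →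
  c ≤ foldr _⊓_ s (map f xs)
foldr-⊓-greatest f []       c≤s c≤f = c≤s
foldr-⊓-greatest f (x ∷ xs) c≤s c≤f = ⊓-glb (c≤f x) (foldr-⊓-greatest f xs c≤s c≤f)

p∪[q-x]≡q : ∀ {n} {p q : Subset n} {x} → x ∈ p → p ⊆ q → p ∪ (q - x) ≡ q
p∪[q-x]≡q {p = p} {q} {x} x∈p p⊆q = ⊆-antisym ⊆q q⊆
  where
  ⊆q : p ∪ (q - x) ⊆ q
  ⊆q y∈ with x∈p∪q⁻ p (q - x) y∈
  ... | inj₁ y∈p   = p⊆q y∈p
  ... | inj₂ y∈q-x = x∈p-y⇒x∈p y∈q-x
  q⊆ : q ⊆ p ∪ (q - x)
  q⊆ {y} y∈q with y ≟ x
  ... | yes refl = x∈p∪q⁺ (inj₁ x∈p)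
  ... | no  y≢x  = x∈p∪q⁺ (inj₂ (x∈p∧x≢y⇒x∈p-y y∈q y≢x))

p∩[q-x]≡p-x : ∀ {n} {p q : Subset n} {x} → p ⊆ q → p ∩ (q - x) ≡ p - x
p∩[q-x]≡p-x {p = p} {q} p⊆q = ⊆-antisym ⊆p-x p-x⊆
  where
  ⊆p-x : p ∩ (q - _) ⊆ p - _
  ⊆p-x y∈ with x∈p∩q⁻ p (q - _) y∈
  ... | y∈p , y∈q-x = x∈p∧x≢y⇒x∈p-y y∈p (x∈p-y⇒x≢y y∈q-x)
  p-x⊆ : p - _ ⊆ p ∩ (q - _)
  p-x⊆ y∈p-x = x∈p∩q⁺ (y∈p , x∈p∧x≢y⇒x∈p-y (p⊆q y∈p) (x∈p-y⇒x≢y y∈p-x))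
    where y∈p = x∈p-y⇒x∈p y∈p-x

restrict : ∀ {n} → Subset n → (Fin n → ℕ) → Fin n → ℕ
restrict S u k = if ⌊ k ∈? S ⌋ then u k else 0

restrict-∈ : ∀ {n} {S : Subset n} {k} u → k ∈ S → restrict S u k ≡ u k
restrict-∈ {S = S} {k} u k∈S with k ∈? S
... | yes _   = refl
... | no  k∉S = contradiction k∈S k∉S

restrict-∉ : ∀ {n} {S : Subset n} {k} u → k ∉ S → restrict S u k ≡ 0
restrict-∉ {S = S} {k} u k∉S with k ∈? S
... | yes k∈S = contradiction k∈S k∉S
... | no  _   = refl

restrict-cong : ∀ {n} {S T : Subset n} {k} u → (k ∈ S → k ∈ T) → (k ∈ T → k ∈ S) →
  restrict S u k ≡ restrict T u k
restrict-cong {S = S} {T} {k} u S⇒T T⇒S with k ∈? S | k ∈? T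
... | yes _   | yes _   = refl
... | yes k∈S | no  k∉T = contradiction (S⇒T k∈S) k∉T
... | no  k∉S | yes k∈T = contradiction (T⇒S k∈T) k∉S
... | no  _   | no  _   = refl

sumOver-cong : ∀ {n} (S : Subset n) {u v} → (∀ k → k ∈ S → u k ≡ v k) → sumOver S u ≡ sumOver S v
sumOver-cong S {u} {v} u≡v = sumFin-cong pointwise
  where
  pointwise : restrict S u ≗ restrict S v
  pointwise k with k ∈? S
  ... | yes k∈S = u≡v k k∈S
  ... | no  _   = refl

sumOver-mono : ∀ {n} (S : Subset n) {u v} → u ≤ᵥ v → sumOver S u ≤ sumOver S v
sumOver-mono S {u} {v} u≤v = sumFin-mono pointwise
  where
  pointwise : restrict S u ≤ᵥ restrict S v
  pointwise k with k ∈? S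
  ... | yes _ = u≤v k
  ... | no  _ = ≤-refl

sumOver-⁅⁆ : ∀ {n} (j : Fin n) u → sumOver ⁅ j ⁆ u ≡ u j
sumOver-⁅⁆ j u =
  trans (sumFin-single j (λ k k≢j → restrict-∉ u (x≢y⇒x∉⁅y⁆ k≢j))) (restrict-∈ u (x∈⁅x⁆ j))

sumOver-remove : ∀ {n} {S : Subset n} {j} u → j ∈ S → sumOver S u ≡ u j + sumOver (S - j) u
sumOver-remove {S = S} {j} u j∈S = begin
  sumFin (restrict S u)
    ≡⟨ sumFin-cong pointwise ⟩
  sumFin (λ k → restrict ⁅ j ⁆ u k + restrict (S - j) u k)
    ≡⟨ sumFin-+ (restrict ⁅ j ⁆ u) (restrict (S - j) u) ⟩
  sumOver ⁅ j ⁆ u + sumOver (S - j) u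
    ≡⟨ cong (_+ sumOver (S - j) u) (sumOver-⁅⁆ j u) ⟩
  u j + sumOver (S - j) u
    ∎
  where
  open ≡-Reasoning
  pointwise : ∀ k → restrict S u k ≡ restrict ⁅ j ⁆ u k + restrict (S - j) u k
  pointwise k with k ≟ j
  ... | yes refl = begin
    restrict S u k                            ≡⟨ restrict-∈ u j∈S ⟩
    u k                                       ≡⟨ +-identityʳ (u k) ⟨
    u k + 0                                   ≡⟨ cong₂ _+_ (restrict-∈ u (x∈⁅x⁆ k)) (restrict-∉ u x∉p-x) ⟨
    restrict ⁅ j ⁆ u k + restrict (S - j) u k ∎
  ... | no  k≢j  = begin
    restrict S u k
      ≡⟨ restrict-cong u (λ k∈S → x∈p∧x≢y⇒x∈p-y k∈S k≢j) x∈p-y⇒x∈p ⟩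
    restrict (S - j) u k
      ≡⟨ cong (_+ restrict (S - j) u k) (restrict-∉ u (x≢y⇒x∉⁅y⁆ k≢j)) ⟨
    restrict ⁅ j ⁆ u k + restrict (S - j) u k
      ∎

sumOver-zero : ∀ {n} (S : Subset n) → sumOver S (const 0) ≡ 0
sumOver-zero S = sumFin-zero zero-restrict
  where
  zero-restrict : ∀ k → restrict S (const 0) k ≡ 0
  zero-restrict k with k ∈? S
  ... | yes _ = refl
  ... | no  _ = refl

SupportedOn : ∀ {n} → Subset n → (Fin n → ℕ) → Set
SupportedOn T u = ∀ k → k ∉ T → u k ≡ 0

sumOver-∩-support : ∀ {n} (S : Subset n) {T u} → SupportedOn T u → sumOver S u ≡ sumOver (S ∩ T) u
sumOver-∩-support S {T} {u} supp = sumFin-cong pointwise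
  where
  pointwise : restrict S u ≗ restrict (S ∩ T) u
  pointwise k with k ∈? S ∩ T
  ... | yes k∈S∩T = restrict-∈ u (proj₁ (x∈p∩q⁻ S T k∈S∩T))
  ... | no  k∉S∩T with k ∈? S | k ∈? T
  ...   | yes k∈S | yes k∈T = contradiction (x∈p∩q⁺ (k∈S , k∈T)) k∉S∩T
  ...   | yes _   | no  k∉T = supp k k∉T
  ...   | no  _   | _       = refl

sumOver-updateAt-∉ : ∀ {n} {S : Subset n} {j} u f → j ∉ S → sumOver S (updateAt u j f) ≡ sumOver S u
sumOver-updateAt-∉ {S = S} {j} u f j∉S = sumOver-cong S λ k k∈S →
  updateAt-minimal k j u λ { refl → j∉S k∈S }

sumOver-updateAt-∈ : ∀ {n} {S : Subset n} {j} u f → j ∈ S →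
  sumOver S (updateAt u j f) ≡ f (u j) + sumOver (S - j) u
sumOver-updateAt-∈ {S = S} {j} u f j∈S = begin
  sumOver S (updateAt u j f)
    ≡⟨ sumOver-remove (updateAt u j f) j∈S ⟩
  updateAt u j f j + sumOver (S - j) (updateAt u j f)
    ≡⟨ cong₂ _+_ (updateAt-updates j u) (sumOver-updateAt-∉ u f x∉p-x) ⟩
  f (u j) + sumOver (S - j) u
    ∎
  where open ≡-Reasoning

-- Independent vectors and circuits of ρ

module _ {n : ℕ} (P : IntPolymatroid n) where
  open IntPolymatroid P

  marginal-gain-antitone : ∀ {S T j c} → j ∈ T → T ⊆ S → ρ (S - j) + c ≤ ρ S → c + ρ (T - j) ≤ ρ T
  marginal-gain-antitone {S} {T} {j} {c} j∈T T⊆S gain = +-cancelˡ-≤ (ρ (S - j)) _ _ (begin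
    ρ (S - j) + (c + ρ (T - j)) ≡⟨ +-assoc (ρ (S - j)) c _ ⟨
    ρ (S - j) + c + ρ (T - j)   ≤⟨ +-monoˡ-≤ _ gain ⟩
    ρ S + ρ (T - j)             ≤⟨ submodular′ ⟩
    ρ T + ρ (S - j)             ≡⟨ +-comm (ρ T) _ ⟩
    ρ (S - j) + ρ T             ∎)
    where
    open ≤-Reasoning
    submodular′ : ρ S + ρ (T - j) ≤ ρ T + ρ (S - j)
    submodular′ = subst₂ (λ U I → ρ U + ρ I ≤ ρ T + ρ (S - j))
      (p∪[q-x]≡q j∈T T⊆S) (p∩[q-x]≡p-x T⊆S) (submodular T (S - j))

  IndepVec-antitone : ∀ {u v} → IndepVec P v → u ≤ᵥ v → IndepVec P u
  IndepVec-antitone v-indep u≤v Z = ≤-trans (sumOver-mono Z u≤v) (v-indep Z)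

  IndepVec-resp-≗ : ∀ {u v} → u ≗ v → IndepVec P u → IndepVec P v
  IndepVec-resp-≗ u≗v u-indep = IndepVec-antitone u-indep (λ k → ≤-reflexive (sym (u≗v k)))

  IndepVec⇒≤ρ₁ : ∀ {u} → IndepVec P u → u ≤ᵥ ρ₁ P
  IndepVec⇒≤ρ₁ {u} u-indep k = subst (_≤ ρ₁ P k) (sumOver-⁅⁆ k u) (u-indep ⁅ k ⁆)

  indepVec? : ∀ u → Dec (IndepVec P u)
  indepVec? u with anySubset? (λ Z → ρ Z <? sumOver Z u)
  ... | yes (Z , violated) = no λ u-indep → <⇒≱ violated (u-indep Z)
  ... | no  none           = yes λ Z → ≮⇒≥ λ violated → none (Z , violated)

  -- CircuitVec P u unfolds to u ≤ᵥ ρ₁ P × MinimalDependent u.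
  MinimalDependent : (Fin n → ℕ) → Set
  MinimalDependent u = ¬ IndepVec P u × (∀ w → w ≤ᵥ u → ¬ w ≗ u → IndepVec P w)

  MinimalDependent-resp-≗ : ∀ {u v} → u ≗ v → MinimalDependent u → MinimalDependent v
  MinimalDependent-resp-≗ u≗v (u-dep , u-minimal) =
    (λ v-indep → u-dep (IndepVec-resp-≗ (sym ∘ u≗v) v-indep)) ,
    (λ w w≤v w≢v → u-minimal w (λ k → subst (w k ≤_) (sym (u≗v k)) (w≤v k))
                                (λ w≗u → w≢v (λ k → trans (w≗u k) (u≗v k))))

  MinimalDependent-intro : ∀ {v} → ¬ IndepVec P v →
    (∀ j → 0 < v j → IndepVec P (updateAt v j pred)) → MinimalDependent v
  MinimalDependent-intro {v} v-dep decrement-indep = v-dep , minimal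
    where
    minimal : ∀ w → w ≤ᵥ v → ¬ w ≗ v → IndepVec P w
    minimal w w≤v w≢v with ¬∀⟶∃¬ n _ (λ k → w k ≟ℕ v k) w≢v
    ... | j , wj≢vj = IndepVec-antitone (decrement-indep j (≤-<-trans z≤n wj<vj))
                        (updateAt-elim (λ k x → w k ≤ x) (<⇒≤pred wj<vj) (λ k _ → w≤v k))
      where
      wj<vj : w j < v j
      wj<vj = ≤∧≢⇒< (w≤v j) wj≢vj

  MinimalDependent-below : ∀ v → ¬ IndepVec P v → ∃ λ u → u ≤ᵥ v × MinimalDependent u
  MinimalDependent-below v = go v (On.wellFounded sumFin <-wellFounded v)
    where
    go : ∀ v → Acc (_<_ on sumFin) v → ¬ IndepVec P v → ∃ λ u → u ≤ᵥ v × MinimalDependent u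
    go v (acc rec) v-dep with any? (λ j → (0 <? v j) ×-dec ¬? (indepVec? (updateAt v j pred)))
    ... | yes (j , 0<vj , decrement-dep) with go _ (rec (sumFin-updateAt-pred-< v 0<vj)) decrement-dep
    ...   | u , u≤ , u-minimal = u , ≤ᵥ-trans u≤ (updateAt-pred-≤ᵥ v j) , u-minimal
    go v (acc rec) v-dep | no none = v , ≤ᵥ-refl , MinimalDependent-intro v-dep
      (λ j 0<vj → decidable-stable (indepVec? _) (λ decrement-dep → none (j , 0<vj , decrement-dep)))

  Basis : Subset n → Set
  Basis S = ∃ λ w → SupportedOn S w × IndepVec P w × ρ S ≤ sumOver S w

  -- The entry added for j is the gain ρ(S) − ρ(S − j); by marginal-gain-antitone it
  -- is also at most the gain of j on every Z ∩ S, which keeps the vector independent.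
  basis : ∀ S → Basis S
  basis = removal-induction Basis basis-∅ basis-insert
    where
    basis-∅ : Basis ∅
    basis-∅ = const 0 , (λ _ _ → refl) , (λ Z → subst (_≤ ρ Z) (sym (sumOver-zero Z)) z≤n) ,
              subst (_≤ _) (sym ρ-empty) z≤n
    basis-insert : ∀ {S j} → j ∈ S → Basis (S - j) → Basis S
    basis-insert {S} {j} j∈S (w′ , w′-supp , w′-indep , w′-span) = w , w-supp , w-indep , w-span
      where
      gain : ∃ λ δ → ρ (S - j) + δ ≡ ρ S
      gain = m≤n⇒∃[o]m+o≡n (monotone (x∈p-y⇒x∈p {p = S}))
      δ : ℕ
      δ = proj₁ gain
      gain≡ : ρ (S - j) + δ ≡ ρ S
      gain≡ = proj₂ gain
      w : Fin n → ℕ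
      w = updateAt w′ j (const δ)
      w-supp : SupportedOn S w
      w-supp = updateAt-elim (λ k x → k ∉ S → x ≡ 0) (contradiction j∈S)
        (λ k _ k∉S → w′-supp k (k∉S ∘ x∈p-y⇒x∈p))
      w-span : ρ S ≤ sumOver S w
      w-span = begin
        ρ S                        ≡⟨ gain≡ ⟨
        ρ (S - j) + δ              ≤⟨ +-monoˡ-≤ δ w′-span ⟩
        sumOver (S - j) w′ + δ     ≡⟨ +-comm _ δ ⟩
        δ + sumOver (S - j) w′     ≡⟨ sumOver-updateAt-∈ w′ (const δ) j∈S ⟨
        sumOver S w                ∎
        where open ≤-Reasoning
      w-indep : IndepVec P w
      w-indep Z with j ∈? Z
      ... | no j∉Z = ≤-trans (≤-reflexive (sumOver-updateAt-∉ w′ (const δ) j∉Z)) (w′-indep Z)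
      ... | yes j∈Z = begin
        sumOver Z w                ≡⟨ sumOver-∩-support Z w-supp ⟩
        sumOver (Z ∩ S) w          ≡⟨ sumOver-updateAt-∈ w′ (const δ) j∈Z∩S ⟩
        δ + sumOver (Z ∩ S - j) w′ ≤⟨ +-monoʳ-≤ δ (w′-indep (Z ∩ S - j)) ⟩
        δ + ρ (Z ∩ S - j)          ≤⟨ marginal-gain-antitone j∈Z∩S (p∩q⊆q Z S) (≤-reflexive gain≡) ⟩
        ρ (Z ∩ S)                  ≤⟨ monotone (p∩q⊆p Z S) ⟩
        ρ Z                        ∎
        where
        open ≤-Reasoning
        j∈Z∩S : j ∈ Z ∩ S
        j∈Z∩S = x∈p∩q⁺ (j∈Z , j∈S)

  CircuitThrough : Subset n → Fin n → Set
  CircuitThrough A i = ∃ λ u → CircuitVec P u × 0 < u i × SupportedOn A u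

  -- Clearing entry i makes v independent, so every circuit below v uses i.
  circuitThrough-below : ∀ {A i} v → v ≤ᵥ ρ₁ P → SupportedOn A v → ¬ IndepVec P v →
    IndepVec P (updateAt v i (const 0)) → CircuitThrough A i
  circuitThrough-below {A} {i} v v≤ρ₁ v-supp v-dep v₀-indep with MinimalDependent-below v v-dep
  ... | u , u≤v , u-minimal = u , (≤ᵥ-trans u≤v v≤ρ₁ , u-minimal) , 0<ui , u-supp
    where
    0<ui : 0 < u i
    0<ui = n≢0⇒n>0 λ ui≡0 → proj₁ u-minimal
      (IndepVec-antitone v₀-indep (updateAt-elim (λ k x → u k ≤ x) (≤-reflexive ui≡0) (λ k _ → u≤v k)))
    u-supp : SupportedOn A u
    u-supp k k∉A = n≤0⇒n≡0 (subst (u k ≤_) (v-supp k k∉A) (u≤v k))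

  cyclicAt⇒circuitThrough : ∀ {A i} → i ∈ A → ρ A < ρ (A - i) + ρ₁ P i → CircuitThrough A i
  cyclicAt⇒circuitThrough {A} {i} i∈A drop with basis (A - i)
  ... | w , w-supp , w-indep , w-span = circuitThrough-below v v≤ρ₁ v-supp v-dep v₀-indep
    where
    v : Fin n → ℕ
    v = updateAt w i (const (ρ₁ P i))
    v≤ρ₁ : v ≤ᵥ ρ₁ P
    v≤ρ₁ = updateAt-elim (λ k x → x ≤ ρ₁ P k) ≤-refl (λ k _ → IndepVec⇒≤ρ₁ w-indep k)
    v-supp : SupportedOn A v
    v-supp = updateAt-elim (λ k x → k ∉ A → x ≡ 0) (contradiction i∈A)
      (λ k _ k∉A → w-supp k (k∉A ∘ x∈p-y⇒x∈p))
    v-dep : ¬ IndepVec P v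
    v-dep v-indep = <⇒≱ drop (begin
      ρ (A - i) + ρ₁ P i         ≤⟨ +-monoˡ-≤ _ w-span ⟩
      sumOver (A - i) w + ρ₁ P i ≡⟨ +-comm _ (ρ₁ P i) ⟩
      ρ₁ P i + sumOver (A - i) w ≡⟨ sumOver-updateAt-∈ w (const (ρ₁ P i)) i∈A ⟨
      sumOver A v                ≤⟨ v-indep A ⟩
      ρ A                        ∎)
      where open ≤-Reasoning
    v₀-indep : IndepVec P (updateAt v i (const 0))
    v₀-indep = IndepVec-antitone w-indep (updateAt-elim (λ k x → x ≤ w k) z≤n
      (λ k k≢i → ≤-reflexive (updateAt-minimal k i w k≢i)))

  circuitThrough⇒cyclicAt : ∀ {A i} → CircuitThrough A i → ρ A < ρ (A - i) + ρ₁ P i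
  circuitThrough⇒cyclicAt {A} {i} (u , (u≤ρ₁ , u-dep , u-minimal) , 0<ui , u-supp) =
    ≰⇒> λ no-drop → u-dep (λ Z → begin
      sumOver Z u       ≡⟨ sumOver-∩-support Z u-supp ⟩
      sumOver (Z ∩ A) u ≤⟨ bounded-within no-drop (p∩q⊆q Z A) ⟩
      ρ (Z ∩ A)         ≤⟨ monotone (p∩q⊆p Z A) ⟩
      ρ Z               ∎)
    where
    open ≤-Reasoning
    u₀ : Fin n → ℕ
    u₀ = updateAt u i (const 0)
    u₀-indep : IndepVec P u₀
    u₀-indep = u-minimal u₀ (updateAt-elim (λ k x → x ≤ u k) z≤n (λ _ _ → ≤-refl))
      (λ u₀≗u → <⇒≢ 0<ui (trans (sym (updateAt-updates i u)) (u₀≗u i)))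
    bounded-within : ρ (A - i) + ρ₁ P i ≤ ρ A → ∀ {Y} → Y ⊆ A → sumOver Y u ≤ ρ Y
    bounded-within no-drop {Y} Y⊆A with i ∈? Y
    ... | no i∉Y = begin
      sumOver Y u  ≡⟨ sumOver-updateAt-∉ u (const 0) i∉Y ⟨
      sumOver Y u₀ ≤⟨ u₀-indep Y ⟩
      ρ Y          ∎
    ... | yes i∈Y = begin
      sumOver Y u               ≡⟨ sumOver-remove u i∈Y ⟩
      u i + sumOver (Y - i) u   ≡⟨ cong (u i +_) (sumOver-updateAt-∉ u (const 0) x∉p-x) ⟨
      u i + sumOver (Y - i) u₀  ≤⟨ +-mono-≤ (u≤ρ₁ i) (u₀-indep (Y - i)) ⟩
      ρ₁ P i + ρ (Y - i)        ≤⟨ marginal-gain-antitone i∈Y Y⊆A no-drop ⟩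
      ρ Y                       ∎

  -- The natural matroid

  sizes : SubE' P → Fin n → ℕ
  sizes Y i = ∣ Y i ∣

  card-split : ∀ Y B → card P Y ≡ sumOver B (sizes Y) + cardOutside P Y B
  card-split Y B = trans (sumFin-cong pointwise) (sumFin-+ (restrict B (sizes Y)) _)
    where
    pointwise : ∀ i → ∣ Y i ∣ ≡ restrict B (sizes Y) i + (if ⌊ i ∈? B ⌋ then 0 else ∣ Y i ∣)
    pointwise i with i ∈? B
    ... | yes _ = sym (+-identityʳ _)
    ... | no  _ = refl

  rank≤ : ∀ Y B → rank P Y ≤ ρ B + cardOutside P Y B
  rank≤ Y B = foldr-⊓-≤ _ _ (allSubsets n) (allSubsets-complete B)

  rank-greatest : ∀ Y {c} → (∀ B → c ≤ ρ B + cardOutside P Y B) → c ≤ rank P Y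
  rank-greatest Y c≤ = foldr-⊓-greatest _ (allSubsets n) (c≤ ∅) c≤

  rank≤card : ∀ Y → rank P Y ≤ card P Y
  rank≤card Y = begin
    rank P Y                                ≤⟨ rank≤ Y ∅ ⟩
    ρ ∅ + cardOutside P Y ∅                 ≡⟨ cong (_+ cardOutside P Y ∅) ρ-empty ⟩
    cardOutside P Y ∅                       ≤⟨ m≤n+m _ _ ⟩
    sumOver ∅ (sizes Y) + cardOutside P Y ∅ ≡⟨ card-split Y ∅ ⟨
    card P Y                                ∎
    where open ≤-Reasoning

  independent⇔IndepVec : ∀ Y → Independent P Y ⇔ IndepVec P (sizes Y)
  independent⇔IndepVec Y = mk⇔ to from
    where
    to : Independent P Y → IndepVec P (sizes Y)
    to rank≡card B = +-cancelʳ-≤ (cardOutside P Y B) _ _ (begin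
      sumOver B (sizes Y) + cardOutside P Y B ≡⟨ card-split Y B ⟨
      card P Y                                ≡⟨ rank≡card ⟨
      rank P Y                                ≤⟨ rank≤ Y B ⟩
      ρ B + cardOutside P Y B                 ∎)
      where open ≤-Reasoning
    from : IndepVec P (sizes Y) → Independent P Y
    from Y-indep = ≤-antisym (rank≤card Y) (rank-greatest Y λ B →
      subst (_≤ ρ B + cardOutside P Y B) (sym (card-split Y B)) (+-monoˡ-≤ _ (Y-indep B)))

  dependent⇔¬IndepVec : ∀ Y → Dependent P Y ⇔ (¬ IndepVec P (sizes Y))
  dependent⇔¬IndepVec Y = mk⇔
    (λ Y-dep Y-indep → <⇒≢ Y-dep (Equivalence.from (independent⇔IndepVec Y) Y-indep))
    (λ ¬Y-indep → ≤∧≢⇒< (rank≤card Y) (¬Y-indep ∘ Equivalence.to (independent⇔IndepVec Y)))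

  MCircuit⇒MinimalDependent : ∀ C → MCircuit P C → MinimalDependent (sizes C)
  MCircuit⇒MinimalDependent C (C-dep , C-minimal) =
    Equivalence.to (dependent⇔¬IndepVec C) C-dep , minimal
    where
    minimal : ∀ w → w ≤ᵥ sizes C → ¬ w ≗ sizes C → IndepVec P w
    minimal w w≤C w≢C with ¬∀⟶∃¬ n _ (λ k → w k ≟ℕ sizes C k) w≢C
    ... | j , wj≢Cj =
      IndepVec-resp-≗ D≗w (Equivalence.to (independent⇔IndepVec D) (C-minimal D D⊆C witness))
      where
      shrink : ∀ k → ∃ λ q → q ⊆ C k × ∣ q ∣ ≡ w k
      shrink k = ∃-⊆-of-size (C k) (w k) (w≤C k)
      D : SubE' P
      D k = proj₁ (shrink k)
      D⊆C : _⊆'_ P D C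
      D⊆C (k , _) = proj₁ (proj₂ (shrink k))
      D≗w : sizes D ≗ w
      D≗w k = proj₂ (proj₂ (shrink k))
      witness : ∃ λ e → _∈'_ P e C × ¬ _∈'_ P e D
      witness with ∣p∣<∣q∣⇒∃∈q∖p (subst (_< ∣ C j ∣) (sym (D≗w j)) (≤∧≢⇒< (w≤C j) wj≢Cj))
      ... | x , x∈Cj , x∉Dj = (j , x) , x∈Cj , x∉Dj

  MinimalDependent⇒MCircuit : ∀ C → MinimalDependent (sizes C) → MCircuit P C
  MinimalDependent⇒MCircuit C (C-dep , C-minimal) =
    Equivalence.from (dependent⇔¬IndepVec C) C-dep , minimal
    where
    minimal : ∀ D → _⊆'_ P D C → (∃ λ e → _∈'_ P e C × ¬ _∈'_ P e D) → Independent P D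
    minimal D D⊆C ((j , x) , x∈Cj , x∉Dj) =
      Equivalence.from (independent⇔IndepVec D) (C-minimal (sizes D) D≤C D≢C)
      where
      D≤C : sizes D ≤ᵥ sizes C
      D≤C k = p⊆q⇒∣p∣≤∣q∣ (λ {y} → D⊆C (k , y))
      D≢C : ¬ sizes D ≗ sizes C
      D≢C D≗C = <-irrefl (D≗C j) (p⊂q⇒∣p∣<∣q∣ ((λ {y} → D⊆C (j , y)) , x , x∈Cj , x∉Dj))

  ∃-SubE'-with-sizes : ∀ {u i} → u ≤ᵥ ρ₁ P → 0 < u i → (x : Fin (ρ₁ P i)) →
    ∃ λ C → sizes C ≗ u × _∈'_ P (i , x) C
  ∃-SubE'-with-sizes {u} {i} u≤ρ₁ 0<ui x = C , sizes-C , x∈Ci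
    where
    C : SubE' P
    C j with j ≟ i
    ... | yes refl = proj₁ (∃-∋-of-size x (u i) 0<ui (u≤ρ₁ i))
    ... | no  _    = proj₁ (∃-of-size (ρ₁ P j) (u j) (u≤ρ₁ j))
    sizes-C : sizes C ≗ u
    sizes-C j with j ≟ i
    ... | yes refl = proj₂ (proj₂ (∃-∋-of-size x (u i) 0<ui (u≤ρ₁ i)))
    ... | no  _    = proj₂ (∃-of-size (ρ₁ P j) (u j) (u≤ρ₁ j))
    x∈Ci : x ∈ C i
    x∈Ci with i ≟ i
    ... | yes refl = proj₁ (proj₂ (∃-∋-of-size x (u i) 0<ui (u≤ρ₁ i)))
    ... | no  i≢i  = contradiction refl i≢i

  ∈-X⁺ : ∀ {A i} {x : Fin (ρ₁ P i)} → i ∈ A → x ∈ X P A i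
  ∈-X⁺ {A} {i} i∈A with i ∈? A
  ... | yes _   = ∈⊤
  ... | no  i∉A = contradiction i∈A i∉A

  ∈-X⁻ : ∀ {A i} {x : Fin (ρ₁ P i)} → x ∈ X P A i → i ∈ A
  ∈-X⁻ {A} {i} x∈ with i ∈? A
  ... | yes i∈A = i∈A
  ... | no  _   = contradiction x∈ ∉⊥

  circuitThrough⇒MCircuit : ∀ {A i} → CircuitThrough A i → (x : Fin (ρ₁ P i)) →
    ∃ λ C → MCircuit P C × _⊆'_ P C (X P A) × _∈'_ P (i , x) C
  circuitThrough⇒MCircuit {A} (u , (u≤ρ₁ , u-minimal) , 0<ui , u-supp) x
    with ∃-SubE'-with-sizes u≤ρ₁ 0<ui x
  ... | C , C≗u , x∈Ci =
    C , MinimalDependent⇒MCircuit C (MinimalDependent-resp-≗ (sym ∘ C≗u) u-minimal) , C⊆X , x∈Ci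
    where
    C⊆X : _⊆'_ P C (X P A)
    C⊆X (j , y) y∈Cj = ∈-X⁺ (decidable-stable (j ∈? A) λ j∉A →
      <⇒≢ (x∈p⇒0<∣p∣ y∈Cj) (sym (trans (C≗u j) (u-supp j j∉A))))

  MCircuit⇒circuitThrough : ∀ {A i C} {x : Fin (ρ₁ P i)} →
    MCircuit P C → _⊆'_ P C (X P A) → _∈'_ P (i , x) C → CircuitThrough A i
  MCircuit⇒circuitThrough {A} {i} {C} C-circuit C⊆X x∈Ci =
    sizes C , (sizes≤ρ₁ , MCircuit⇒MinimalDependent C C-circuit) , x∈p⇒0<∣p∣ x∈Ci , C-supp
    where
    sizes≤ρ₁ : sizes C ≤ᵥ ρ₁ P
    sizes≤ρ₁ k = ∣p∣≤n (C k)
    C-supp : SupportedOn A (sizes C)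
    C-supp j j∉A = n≤0⇒n≡0 (subst (∣ C j ∣ ≤_) (∣⊥∣≡0 (ρ₁ P j)) (p⊆q⇒∣p∣≤∣q∣ Cj⊆∅))
      where
      Cj⊆∅ : C j ⊆ ∅
      Cj⊆∅ {y} y∈Cj = contradiction (∈-X⁻ (C⊆X (j , y) y∈Cj)) j∉A

lemma5p8 : (n : ℕ) (P : IntPolymatroid n) (A : Subset n) →
    (Cyclic P A ⇔ MCyclic P (X P A)) × (Cyclic P A ⇔ Cond3 P A)
lemma5p8 n P A = mk⇔ cyclic⇒MCyclic MCyclic⇒cyclic , mk⇔ cyclic⇒cond3 cond3⇒cyclic
  where
  cyclic⇒cond3 : Cyclic P A → Cond3 P A
  cyclic⇒cond3 cyclic i i∈A with ρ₁ P i ≟ℕ 0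
  ... | yes ρi≡0 = inj₁ ρi≡0
  ... | no  ρi≢0 = inj₂ (cyclicAt⇒circuitThrough P i∈A (cyclic i i∈A (n≢0⇒n>0 ρi≢0)))

  cond3⇒cyclic : Cond3 P A → Cyclic P A
  cond3⇒cyclic cond3 i i∈A 0<ρi with cond3 i i∈A
  ... | inj₁ ρi≡0   = contradiction ρi≡0 (n>0⇒n≢0 0<ρi)
  ... | inj₂ circuit = circuitThrough⇒cyclicAt P circuit

  cyclic⇒MCyclic : Cyclic P A → MCyclic P (X P A)
  cyclic⇒MCyclic cyclic (i , x) x∈XAi = circuitThrough⇒MCircuit P
    (cyclicAt⇒circuitThrough P i∈A (cyclic i i∈A (>-nonZero⁻¹ _ {{nonZeroIndex x}}))) x
    where
    i∈A : i ∈ A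
    i∈A = ∈-X⁻ P x∈XAi

  MCyclic⇒cyclic : MCyclic P (X P A) → Cyclic P A
  MCyclic⇒cyclic mcyclic i i∈A 0<ρi with mcyclic (i , fromℕ< 0<ρi) (∈-X⁺ P i∈A)
  ... | C , C-circuit , C⊆X , x∈Ci =
    circuitThrough⇒cyclicAt P (MCircuit⇒circuitThrough P C-circuit C⊆X x∈Ci)
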